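{- Let $p$ be an ideal prime for a strong divisibility sequence $C$, with associated integer $s(p)\ge1$. Then for any integer $n\ge0$, \[ \nu_p(n!_C)=s(p)\left\lfloor\frac{n}{\alpha(p)}\right\rfloor+\nu_p\!\left(\left\lfloor\frac{n}{\alpha(p)}\right\rfloor!\right). \]
   Context: A strong divisibility sequence is a sequence $C=C_1,C_2,\dots$ of nonzero integers with $\gcd(C_n,C_m)=C_{\gcd(n,m)}$ for all positive $n,m$. The $C$-orial is $0!_C=1$, $n!_C=C_nC_{n-1}\cdots C_1$ for $n\ge1$. $\nu_p$ is the $p$-adic valuation. The rank of apparition $\alpha(m)$ is the least index $j\ge1$ with $m\mid C_j$ (if it exists). When $\alpha(p^k)$ exists for all $k\ge1$, set $a_k(p)=\alpha(p^k)/\alpha(p^{k-1})$ for $k\ge2$. The prime $p$ is ideal for $C$ if $\alpha(p^k)$ exists for all $k\ge1$ and there is an integer $s(p)\ge1$ with $a_k(p)=1$ for $2\le k\le s(p)$ and $a_k(p)=p$ for $k>s(p)$. -}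

module Defs where

open import Data.Nat as ℕ using (ℕ; zero; suc; _≤_; _<_; _^_; NonZero)
open import Data.Nat.GCD using (gcd)
open import Data.Nat.DivMod using (_/_)
open import Data.Nat.Base using (>-nonZero)
open import Data.Integer as ℤ using (ℤ; +_; ∣_∣)
open import Data.Integer.Divisibility using () renaming (_∣_ to _∣ℤ_)
open import Data.Product using (_×_; proj₁)
open import Relation.Nullary using (¬_)
open import Relation.Binary.PropositionalEquality using (_≡_; _≢_)

-- A sequence C₁, C₂, … of integers is modelled as C : ℕ → ℤ; only the
-- values at indices ≥ 1 are relevant (C 0 is ignored).
record IsStrongDivSeq (C : ℕ → ℤ) : Set where
  field
    nonzero : ∀ n → 1 ≤ n → C n ≢ + 0
    strong  : ∀ n m → 1 ≤ n → 1 ≤ m → + gcd ∣ C n ∣ ∣ C m ∣ ≡ C (gcd n m)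

_!C_ : ℕ → (ℕ → ℤ) → ℤ
zero  !C C = + 1
suc n !C C = C (suc n) ℤ.* (n !C C)

-- p-adic valuation (as a relation): ν_p(x) = k  iff  p^k ∣ x  and  p^(k+1) ∤ x
-- (used only for nonzero x, where it is unique).
IsValuation : ℕ → ℤ → ℕ → Set
IsValuation p x k = (+ (p ^ k) ∣ℤ x) × ¬ (+ (p ^ suc k) ∣ℤ x)

IsRankOfApparition : (ℕ → ℤ) → ℕ → ℕ → Set
IsRankOfApparition C m j =
  (1 ≤ j) × (+ m ∣ℤ C j) × (∀ i → 1 ≤ i → i < j → ¬ (+ m ∣ℤ C i))

-- p is ideal for C with associated integer s = s(p).
-- α k stands for α(p^k); a_k = α(p^k)/α(p^(k-1)) = a  is written as
-- α(p^k) = a * α(p^(k-1)) (α(p^(k-1)) ≥ 1).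
record IsIdealPrime (C : ℕ → ℤ) (p : ℕ) (s : ℕ) : Set where
  field
    α      : ℕ → ℕ
    rank   : ∀ k → 1 ≤ k → IsRankOfApparition C (p ^ k) (α k)
    s≥1    : 1 ≤ s
    a-one  : ∀ k → 2 ≤ k → k ≤ s → α k ≡ 1 ℕ.* α (ℕ.pred k)
    a-p    : ∀ k → s < k → α k ≡ p ℕ.* α (ℕ.pred k)

αp : ∀ {C p s} → IsIdealPrime C p s → ℕ
αp I = IsIdealPrime.α I 1

αp≥1 : ∀ {C p s} (I : IsIdealPrime C p s) → 1 ≤ αp I
αp≥1 I = proj₁ (IsIdealPrime.rank I 1 (ℕ.s≤s ℕ.z≤n))

⌊_/αp_⌋ : ∀ {C p s} → ℕ → IsIdealPrime C p s → ℕ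
⌊ n /αp I ⌋ = _/_ n (αp I) {{>-nonZero (αp≥1 I)}}

{-# OPTIONS --safe #-}
-- Strong divisibility makes m ∣ C_i equivalent to α(m) ∣ i.  For an ideal
-- prime, α(p^(s+w)) = p^w α(p), so ν_p(C_j) = 0 unless α(p) ∣ j, and
-- ν_p(C_{tα(p)}) = s + ν_p(t).  Hence only the multiples tα(p) ≤ n
-- contribute to ν_p(n!_C), and they contribute Σ_{t ≤ ⌊n/α(p)⌋} (s + ν_p(t)).
module Submission where

open import Defs
open import Data.Nat using (ℕ; _*_; _+_; _!)
open import Data.Nat.Primality using (Prime)
open import Data.Integer using (ℤ; +_)

open import Data.Nat.Base
  using (zero; suc; pred; z≤n; s≤s; _≤_; _<_; _^_; NonZero; NonTrivial; >-nonZero; ≢-nonZero⁻¹; nonTrivial⇒≢1)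
open import Data.Nat.Properties
open import Data.Nat.Divisibility
open import Data.Nat.DivMod using (_/_; _%_; m≡m%n+[m/n]*n; m%n<n)
open import Data.Nat.GCD using (gcd; gcd[m,n]∣m; gcd[m,n]∣n; gcd[m,n]≤n; gcd-greatest; gcd[m,n]≢0)
open import Data.Nat.Induction using (<-rec)
open import Data.Nat.Primality using (euclidsLemma; prime⇒nonZero; prime⇒nonTrivial)
open import Data.Nat.Tactic.RingSolver using (solve-∀)
open import Algebra.Properties.CommutativeSemigroup *-commutativeSemigroup
  using () renaming (interchange to *-interchange)
open import Data.Integer using (∣_∣)
open import Data.Integer.Properties using (abs-*)
open import Data.Product using (∃; _×_; _,_)
open import Data.Sum using (inj₂; [_,_])
open import Function.Base using (_∘_)
open import Relation.Nullary using (¬_; yes; no)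
open import Relation.Binary.PropositionalEquality
  using (_≡_; refl; sym; trans; cong; cong₂; subst; subst₂; module ≡-Reasoning)

-- A record rather than a product, so that p, x and k can be inferred from a proof.
record IsValuationℕ (p x k : ℕ) : Set where
  constructor mkValuation
  field
    p^k∣x     : p ^ k ∣ x
    p^[1+k]∤x : ¬ p ^ suc k ∣ x

-- Divisibility on ℤ is defined as divisibility of absolute values, so these
-- are mere repackagings.
fromIsValuation : ∀ {p k} x → IsValuation p x k → IsValuationℕ p ∣ x ∣ k
fromIsValuation _ (p^k∣x , p^[1+k]∤x) = mkValuation p^k∣x p^[1+k]∤x

toIsValuation : ∀ {p k} x → IsValuationℕ p ∣ x ∣ k → IsValuation p x k
toIsValuation _ (mkValuation p^k∣x p^[1+k]∤x) = p^k∣x , p^[1+k]∤x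

n∣m⇒gcd[m,n]≡n : ∀ {m n} → n ∣ m → gcd m n ≡ n
n∣m⇒gcd[m,n]≡n {m} {n} n∣m = ∣-antisym (gcd[m,n]∣n m n) (gcd-greatest n∣m ∣-refl)

∣!C∣-pred : ∀ C n .{{_ : NonZero n}} → ∣ n !C C ∣ ≡ ∣ C n ∣ * ∣ pred n !C C ∣
∣!C∣-pred C (suc n) = abs-* (C (suc n)) (n !C C)

^-monoʳ-∣ : ∀ b {m n} → m ≤ n → b ^ m ∣ b ^ n
^-monoʳ-∣ b {m} m≤n with m≤n⇒∃[o]m+o≡n m≤n
... | o , refl = divides (b ^ o) (trans (^-distribˡ-+-* b m o) (*-comm (b ^ m) (b ^ o)))

module Valuation {p : ℕ} (p-prime : Prime p) where
  open IsValuationℕ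

  instance
    p-nonZero : NonZero p
    p-nonZero = prime⇒nonZero p-prime

    p-nonTrivial : NonTrivial p
    p-nonTrivial = prime⇒nonTrivial p-prime

  p∤1 : ¬ p ∣ 1
  p∤1 = nonTrivial⇒≢1 ∘ ∣1⇒≡1

  valuation-≤ : ∀ {x k b} → p ^ k ∣ x → IsValuationℕ p x b → k ≤ b
  valuation-≤ p^k∣x (mkValuation _ p^[1+b]∤x) =
    ≮⇒≥ λ b<k → p^[1+b]∤x (∣-trans (^-monoʳ-∣ p b<k) p^k∣x)

  valuation-unique : ∀ {x a b} → IsValuationℕ p x a → IsValuationℕ p x b → a ≡ b
  valuation-unique νa νb = ≤-antisym (valuation-≤ (p^k∣x νa) νb) (valuation-≤ (p^k∣x νb) νa)

  valuation-zero : ∀ {x} → ¬ p ∣ x → IsValuationℕ p x 0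
  valuation-zero {x} p∤x = mkValuation (1∣ x) (p∤x ∘ m*n∣⇒m∣ p 1)

  valuation-*p^ : ∀ {m k} → ¬ p ∣ m → IsValuationℕ p (m * p ^ k) k
  valuation-*p^ {m} {k} p∤m = mkValuation (n∣m*n m) (p∤m ∘ *-cancelʳ-∣ (p ^ k) {{m^n≢0 p k}})

  valuation⇒*p^ : ∀ {x k} → IsValuationℕ p x k → ∃ λ m → x ≡ m * p ^ k × ¬ p ∣ m
  valuation⇒*p^ {k = k} (mkValuation (divides m refl) p^[1+k]∤x) = m , refl , p^[1+k]∤x ∘ *-monoˡ-∣ (p ^ k)

  valuation-* : ∀ {x y a b} → IsValuationℕ p x a → IsValuationℕ p y b
              → IsValuationℕ p (x * y) (a + b)
  valuation-* {x} {y} {a} {b} νx νy with valuation⇒*p^ νx | valuation⇒*p^ νy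
  ... | m , x≡m*p^a , p∤m | n , y≡n*p^b , p∤n =
    subst (λ z → IsValuationℕ p z (a + b)) (sym xy≡mn*p^[a+b]) (valuation-*p^ p∤mn)
    where
    p∤mn : ¬ p ∣ m * n
    p∤mn = [ p∤m , p∤n ] ∘ euclidsLemma m n p-prime
    xy≡mn*p^[a+b] : x * y ≡ m * n * p ^ (a + b)
    xy≡mn*p^[a+b] = begin
      x * y                     ≡⟨ cong₂ _*_ x≡m*p^a y≡n*p^b ⟩
      m * p ^ a * (n * p ^ b)   ≡⟨ *-interchange m (p ^ a) n (p ^ b) ⟩
      m * n * (p ^ a * p ^ b)   ≡⟨ cong (m * n *_) (^-distribˡ-+-* p a b) ⟨
      m * n * p ^ (a + b)       ∎
      where open ≡-Reasoning

  valuation-self : IsValuationℕ p p 1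
  valuation-self =
    subst (λ z → IsValuationℕ p z 1) (trans (*-identityˡ (p * 1)) (*-identityʳ p)) (valuation-*p^ p∤1)

  valuation-exists : ∀ x {{_ : NonZero x}} → ∃ (IsValuationℕ p x)
  valuation-exists x {{x≢0}} = <-rec (λ x → NonZero x → ∃ (IsValuationℕ p x)) step x x≢0
    where
    step : ∀ x → (∀ {y} → y < x → NonZero y → ∃ (IsValuationℕ p y))
         → NonZero x → ∃ (IsValuationℕ p x)
    step x rec x≢0 with p ∣? x
    ... | no p∤x = 0 , valuation-zero p∤x
    ... | yes p∣x@(divides q refl)
      with rec (quotient-< p∣x {{p-nonTrivial}} {{x≢0}}) (quotient≢0 p∣x {{x≢0}})
    ...   | k , νq = suc k , subst (IsValuationℕ p (q * p)) (+-comm k 1) (valuation-* νq valuation-self)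

module StrongDivisibility {C : ℕ → ℤ} (C-sds : IsStrongDivSeq C) where
  open IsStrongDivSeq C-sds

  ∣C∣-gcd : ∀ {i j} → 1 ≤ i → 1 ≤ j → ∣ C (gcd i j) ∣ ≡ gcd ∣ C i ∣ ∣ C j ∣
  ∣C∣-gcd {i} {j} i≥1 j≥1 = sym (cong ∣_∣ (strong i j i≥1 j≥1))

  rank∣⇒∣C : ∀ {m j i} → IsRankOfApparition C m j → 1 ≤ i → j ∣ i → m ∣ ∣ C i ∣
  rank∣⇒∣C {m} {j} {i} (j≥1 , m∣Cⱼ , _) i≥1 j∣i =
    ∣-trans m∣Cⱼ (subst (_∣ ∣ C i ∣) gcd[Cᵢ,Cⱼ]≡Cⱼ (gcd[m,n]∣m ∣ C i ∣ ∣ C j ∣))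
    where
    gcd[Cᵢ,Cⱼ]≡Cⱼ : gcd ∣ C i ∣ ∣ C j ∣ ≡ ∣ C j ∣
    gcd[Cᵢ,Cⱼ]≡Cⱼ = trans (sym (∣C∣-gcd i≥1 j≥1)) (cong (∣_∣ ∘ C) (n∣m⇒gcd[m,n]≡n j∣i))

  ∣C⇒rank∣ : ∀ {m j i} → IsRankOfApparition C m j → 1 ≤ i → m ∣ ∣ C i ∣ → j ∣ i
  ∣C⇒rank∣ {m} {j} {i} (j≥1 , m∣Cⱼ , m∤Cᵢ<ⱼ) i≥1 m∣Cᵢ =
    subst (_∣ i) gcd[i,j]≡j (gcd[m,n]∣m i j)
    where
    instance _ = >-nonZero j≥1
    gcd[i,j]≥1 : 1 ≤ gcd i j
    gcd[i,j]≥1 = n≢0⇒n>0 (gcd[m,n]≢0 i j (inj₂ (≢-nonZero⁻¹ j)))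
    m∣C[gcd[i,j]] : m ∣ ∣ C (gcd i j) ∣
    m∣C[gcd[i,j]] = subst (m ∣_) (sym (∣C∣-gcd i≥1 j≥1)) (gcd-greatest m∣Cᵢ m∣Cⱼ)
    gcd[i,j]≡j : gcd i j ≡ j
    gcd[i,j]≡j = ≤∧≮⇒≡ (gcd[m,n]≤n i j) λ gcd<j →
      m∤Cᵢ<ⱼ (gcd i j) gcd[i,j]≥1 gcd<j m∣C[gcd[i,j]]

module IdealPrime {C : ℕ → ℤ} (C-sds : IsStrongDivSeq C) {p : ℕ} (p-prime : Prime p)
                  {s : ℕ} (I : IsIdealPrime C p s) where
  open IsIdealPrime I
  open StrongDivisibility C-sds
  open Valuation p-prime

  instance
    α[p]-nonZero : NonZero (α 1)
    α[p]-nonZero = >-nonZero (αp≥1 I)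

  w+s≥1 : ∀ w → 1 ≤ w + s
  w+s≥1 w = ≤-trans s≥1 (m≤n+m s w)

  α[p^k]≡α[p] : ∀ k → 1 ≤ k → k ≤ s → α k ≡ α 1
  α[p^k]≡α[p] (suc zero)    _ _      = refl
  α[p^k]≡α[p] (suc (suc k)) _ 2+k≤s = begin
    α (2 + k)      ≡⟨ a-one (2 + k) (s≤s (s≤s z≤n)) 2+k≤s ⟩
    1 * α (1 + k)  ≡⟨ *-identityˡ _ ⟩
    α (1 + k)      ≡⟨ α[p^k]≡α[p] (suc k) (s≤s z≤n) (≤-trans (n≤1+n _) 2+k≤s) ⟩
    α 1            ∎
    where open ≡-Reasoning

  α[p^[w+s]]≡p^w*α[p] : ∀ w → α (w + s) ≡ p ^ w * α 1
  α[p^[w+s]]≡p^w*α[p] zero    = trans (α[p^k]≡α[p] s s≥1 ≤-refl) (sym (*-identityˡ _))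
  α[p^[w+s]]≡p^w*α[p] (suc w) = begin
    α (suc w + s)        ≡⟨ a-p (suc w + s) (s≤s (m≤n+m s w)) ⟩
    p * α (w + s)        ≡⟨ cong (p *_) (α[p^[w+s]]≡p^w*α[p] w) ⟩
    p * (p ^ w * α 1)    ≡⟨ *-assoc p (p ^ w) (α 1) ⟨
    p ^ suc w * α 1      ∎
    where open ≡-Reasoning

  p^[w+s]∣C⇒p^w*α[p]∣ : ∀ w {j} → 1 ≤ j → p ^ (w + s) ∣ ∣ C j ∣ → p ^ w * α 1 ∣ j
  p^[w+s]∣C⇒p^w*α[p]∣ w j≥1 p^[w+s]∣Cⱼ =
    subst (_∣ _) (α[p^[w+s]]≡p^w*α[p] w) (∣C⇒rank∣ (rank (w + s) (w+s≥1 w)) j≥1 p^[w+s]∣Cⱼ)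

  p^w*α[p]∣⇒p^[w+s]∣C : ∀ w {j} → 1 ≤ j → p ^ w * α 1 ∣ j → p ^ (w + s) ∣ ∣ C j ∣
  p^w*α[p]∣⇒p^[w+s]∣C w j≥1 p^w*α[p]∣j =
    rank∣⇒∣C (rank (w + s) (w+s≥1 w)) j≥1 (subst (_∣ _) (sym (α[p^[w+s]]≡p^w*α[p] w)) p^w*α[p]∣j)

  valuation-C-nonmultiple : ∀ {j} → 1 ≤ j → ¬ α 1 ∣ j → IsValuationℕ p ∣ C j ∣ 0
  valuation-C-nonmultiple {j} j≥1 α[p]∤j = valuation-zero λ p∣Cⱼ →
    α[p]∤j (∣C⇒rank∣ (rank 1 (s≤s z≤n)) j≥1 (∣-trans (∣-reflexive (*-identityʳ p)) p∣Cⱼ))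

  valuation-C-multiple : ∀ {t w} → 1 ≤ t → IsValuationℕ p t w
                       → IsValuationℕ p ∣ C (t * α 1) ∣ (w + s)
  valuation-C-multiple {t} {w} t≥1 (mkValuation p^w∣t p^[1+w]∤t) = mkValuation
    (p^w*α[p]∣⇒p^[w+s]∣C w tα≥1 (*-monoˡ-∣ (α 1) p^w∣t))
    (p^[1+w]∤t ∘ *-cancelʳ-∣ (α 1) ∘ p^[w+s]∣C⇒p^w*α[p]∣ (suc w) tα≥1)
    where
    tα≥1 : 1 ≤ t * α 1
    tα≥1 = *-mono-≤ t≥1 (αp≥1 I)

  valuation-!C-remainder : ∀ q {x} r → r < α 1 → IsValuationℕ p ∣ (q * α 1) !C C ∣ x
                         → IsValuationℕ p ∣ (r + q * α 1) !C C ∣ x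
  valuation-!C-remainder q     zero    _     ν = ν
  valuation-!C-remainder q {x} (suc r) 1+r<α ν =
    subst (λ z → IsValuationℕ p z x) (sym (∣!C∣-pred C (suc r + q * α 1)))
      (valuation-* (valuation-C-nonmultiple (s≤s z≤n) α∤1+r+qα)
                   (valuation-!C-remainder q r (<⇒≤ 1+r<α) ν))
    where
    α∤1+r+qα : ¬ α 1 ∣ suc r + q * α 1
    α∤1+r+qα α∣ =
      >⇒∤ 1+r<α (∣m+n∣m⇒∣n (subst (α 1 ∣_) (+-comm (suc r) (q * α 1)) α∣) (n∣m*n q))

  valuation-!C-multiple : ∀ q {v} → IsValuationℕ p (q !) v
                        → IsValuationℕ p ∣ (q * α 1) !C C ∣ (s * q + v)
  valuation-!C-multiple zero ν[0!] =
    subst (IsValuationℕ p 1) (cong₂ _+_ (sym (*-zeroʳ s)) (valuation-unique ν[1] ν[0!])) ν[1]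
    where
    ν[1] : IsValuationℕ p 1 0
    ν[1] = valuation-zero p∤1
  valuation-!C-multiple (suc q) {v} ν[[1+q]!]
    with valuation-exists (suc q) | valuation-exists (q !) {{q !≢0}}
  ... | w , ν[1+q] | u , ν[q!] =
    subst₂ (IsValuationℕ p) (sym (∣!C∣-pred C (suc q * α 1) {{m*n≢0 (suc q) (α 1)}})) exponent≡
      (valuation-* (valuation-C-multiple (s≤s z≤n) ν[1+q]) ν[[[1+q]α-1]!C])
    where
    ν[[[1+q]α-1]!C] : IsValuationℕ p ∣ pred (suc q * α 1) !C C ∣ (s * q + u)
    ν[[[1+q]α-1]!C] =
      subst (λ m → IsValuationℕ p ∣ m !C C ∣ (s * q + u)) (sym (+-∸-comm (q * α 1) (αp≥1 I)))
        (valuation-!C-remainder q (pred (α 1)) (≤-reflexive (suc-pred (α 1))) (valuation-!C-multiple q ν[q!]))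
    w+u≡v : w + u ≡ v
    w+u≡v = valuation-unique (valuation-* ν[1+q] ν[q!]) ν[[1+q]!]
    regroup : ∀ w s q u → (w + s) + (s * q + u) ≡ s * suc q + (w + u)
    regroup = solve-∀
    exponent≡ : (w + s) + (s * q + u) ≡ s * suc q + v
    exponent≡ = trans (regroup w s q u) (cong (_+_ (s * suc q)) w+u≡v)

lemma3p1 : (C : ℕ → ℤ) → IsStrongDivSeq C → (p : ℕ) → Prime p → (s : ℕ) → (I : IsIdealPrime C p s)
         → (n v : ℕ) → IsValuation p (+ (⌊ n /αp I ⌋ !)) v
         → IsValuation p (n !C C) (s * ⌊ n /αp I ⌋ + v)
lemma3p1 C C-sds p p-prime s I n v ν[q!] =
  toIsValuation (n !C C)
    (subst (λ m → IsValuationℕ p ∣ m !C C ∣ (s * q + v)) (sym n≡r+qα) ν[[r+qα]!C])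
  where
  open IsIdealPrime I using (α)
  open IdealPrime C-sds p-prime I
  q r : ℕ
  q = n / α 1
  r = n % α 1
  n≡r+qα : n ≡ r + q * α 1
  n≡r+qα = m≡m%n+[m/n]*n n (α 1)
  ν[[r+qα]!C] : IsValuationℕ p ∣ (r + q * α 1) !C C ∣ (s * q + v)
  ν[[r+qα]!C] = valuation-!C-remainder q r (m%n<n n (α 1))
                  (valuation-!C-multiple q (fromIsValuation (+ (q !)) ν[q!]))
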